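{- For every admissible neighborly partition $\lambda$, $\operatorname{sign}(\lambda)=(-1)^{e(G'_\lambda)}$, where $e(G'_\lambda)$ is the number of edges of the graph $G'_\lambda$.
   Context: Partitions are written with parts in increasing order. A partition $\lambda$ is neighborly if every value occurs as a part at most twice and for every part $\lambda_i$ there is a part $\lambda_j$ with $j\ne i$ and $|\lambda_i-\lambda_j|\le 1$. Write $\lambda=(\mu_1,\mu_2)$ where $\mu_1$ is the set of distinct part values and $\mu_2\subseteq\mu_1$ the set of values occurring twice. The graph $G_\lambda$ has one vertex $v$ for each $v\in\mu_1$ and one additional vertex $v'$ for each $v\in\mu_2$; its edges are the backbone edges $\{v,v+1\}$ whenever $v,v+1\in\mu_1$, and the hanging edges $\{v,v'\}$ for $v\in\mu_2$. Chains: each connected component $c$ of $G_\lambda$ has backbone vertices forming a maximal run $\{k,\dots,n\}$ of consecutive integers in $\mu_1$; let $a_1<\dots<a_s$ be the elements of $\mu_2$ in it. If $s=0$, $c$ has the single chain $k,k+1,\dots,n$ (a path with $n-k$ edges). If $s\ge1$, $c$ has the chains (paths, listed with edges ordered left to right) $k,k+1,\dots,a_1,a_1'$ (with $a_1-k+1$ edges); $a_{i}',a_{i},a_{i}+1,\dots,a_{i+1},a_{i+1}'$ for $1\le i<s$ (with $a_{i+1}-a_i+2$ edges); and $a_s',a_s,a_s+1,\dots,n$ (with $n-a_s+1$ edges). So each hanging edge lies in exactly two chains. $SIG(G_\lambda)$ is the multiset of the numbers of edges of all chains of all components. $\lambda$ is admissible if no chain has a number of edges divisible by $3$; then $\operatorname{sign}(\lambda)=(-1)^{t+s}$,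 with $t$ the number of chains whose number of edges is $\equiv1\pmod 3$ and $s$ the number of parts of $\mu_2$. $G'_\lambda$: for admissible $\lambda$, from each chain with edges $e_1,\dots,e_m$ (left to right) delete: $e_3,e_6,\dots,e_{m-2}$ if $m\equiv 2\pmod 3$; $e_3,e_6,\dots,e_{3p}$ and $e_{3p+2},e_{3p+5},\dots,e_{6p-1}$ if $m=6p+1$; $e_3,e_6,\dots,e_{3p}$ and $e_{3p+2},e_{3p+5},\dots,e_{6p+2}$ if $m=6p+4$. $G'_\lambda$ is $G_\lambda$ with all these edges removed (same vertices and labels; hanging edges are never removed). -}

module Defs where

open import Data.Nat using (ℕ; zero; suc; _+_; _*_; _∸_; _≤_; _<_; _≟_; _≤?_; ∣_-_∣; _%_; _/_)
open import Data.Nat.Divisibility using (_∣_)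
open import Data.Integer using (ℤ; -1ℤ; _^_)
open import Data.Bool using (Bool; true; false; if_then_else_)
open import Data.Product using (_×_; _,_; Σ; ∃; ∃-syntax)
open import Data.Maybe using (Maybe; just; nothing)
open import Data.List using (List; []; _∷_; _++_; [_]; map; filter; length; concatMap;
  applyUpTo; deduplicate; lookup)
open import Data.List.Relation.Unary.All using (All)
open import Data.List.Relation.Unary.Linked using (Linked)
open import Data.Fin using (Fin)
open import Relation.Nullary using (¬_; Dec; yes; no; does)
open import Relation.Nullary.Decidable using (_×-dec_; ¬?)
open import Relation.Binary.PropositionalEquality using (_≡_; _≢_; refl; cong)
open import Relation.Binary.Definitions using (DecidableEquality)

mult : ℕ → List ℕ → ℕ
mult v ps = length (filter (_≟ v) ps)

record IsPartition (ps : List ℕ) : Set where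
  field
    positive : All (λ x → 1 ≤ x) ps
    sorted   : Linked _≤_ ps

record Neighborly (ps : List ℕ) : Set where
  field
    atMostTwice : ∀ v → mult v ps ≤ 2
    neighbour   : ∀ (i : Fin (length ps)) →
                  ∃[ j ] (j ≢ i × ∣ lookup ps i - lookup ps j ∣ ≤ 1)

μ₁ : List ℕ → List ℕ
μ₁ ps = deduplicate _≟_ ps

μ₂ : List ℕ → List ℕ
μ₂ ps = filter (λ v → mult v ps ≟ 2) (μ₁ ps)

data Edge : Set where
  backbone : ℕ → Edge   -- the edge {v, v+1}
  hanging  : ℕ → Edge   -- the edge {v, v'}

_≟E_ : DecidableEquality Edge
backbone x ≟E backbone y with x ≟ y
... | yes refl = yes refl
... | no ne = no λ { refl → ne refl }
backbone x ≟E hanging y = no λ ()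
hanging x ≟E backbone y = no λ ()
hanging x ≟E hanging y with x ≟ y
... | yes refl = yes refl
... | no ne = no λ { refl → ne refl }

_∈?E_ : (e : Edge) → (es : List Edge) → Bool
e ∈?E [] = false
e ∈?E (f ∷ es) = if does (e ≟E f) then true else (e ∈?E es)

_∈?ℕ_ : ℕ → List ℕ → Bool
v ∈?ℕ [] = false
v ∈?ℕ (w ∷ ws) = if does (v ≟ w) then true else (v ∈?ℕ ws)

edgesG : List ℕ → List Edge
edgesG ps =
  map backbone (filter (λ v → Data.Bool._≟_ (suc v ∈?ℕ μ₁ ps) true) (μ₁ ps))
  ++ map hanging (μ₂ ps)

-- Components: maximal runs {k,…,n} of consecutive integers of an
-- increasing list, given as pairs (k , n)

runs : List ℕ → List (ℕ × ℕ)
runs [] = []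
runs (x ∷ xs) with runs xs
... | [] = (x , x) ∷ []
... | (k , n) ∷ rs with k ≟ suc x
...   | yes _ = (x , n) ∷ rs
...   | no _  = (x , x) ∷ (k , n) ∷ rs

bb : ℕ → ℕ → List Edge
bb a b = applyUpTo (λ i → backbone (a + i)) (b ∸ a)

-- chains after the first one, for hanging points a < a₂ < … , up to n
laterChains : ℕ → ℕ → List ℕ → List (List Edge)
laterChains n a [] = (hanging a ∷ bb a n) ∷ []
laterChains n a (b ∷ r) = (hanging a ∷ bb a b ++ [ hanging b ]) ∷ laterChains n b r

-- chains of the component with backbone {k..n} and hanging points as
componentChains : ℕ → ℕ → List ℕ → List (List Edge)
componentChains k n [] = bb k n ∷ []
componentChains k n (a ∷ as) = (bb k a ++ [ hanging a ]) ∷ laterChains n a as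

chains : List ℕ → List (List Edge)
chains ps = concatMap comp (runs (μ₁ ps))
  where
  comp : ℕ × ℕ → List (List Edge)
  comp (k , n) = componentChains k n (filter (λ a → (k ≤? a) ×-dec (a ≤? n)) (μ₂ ps))

SIG : List ℕ → List ℕ
SIG ps = map length (chains ps)

Admissible : List ℕ → Set
Admissible ps = All (λ m → ¬ (3 ∣ m)) (SIG ps)

-- t = number of chains with #edges ≡ 1 (mod 3); s = |μ₂|
sign : List ℕ → ℤ
sign ps = -1ℤ ^ (length (filter (λ m → m % 3 ≟ 1) (SIG ps)) + length (μ₂ ps))

-- 1-indexed positions (in a chain with m edges) of the deleted edges
deletedPositions : ℕ → List ℕ
deletedPositions m with m % 3 ≟ 2 | m % 6 ≟ 1 | m % 6 ≟ 4
... | yes _ | _ | _ = applyUpTo (λ j → 3 * suc j) (m / 3)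
... | no _ | yes _ | _ = applyUpTo (λ j → 3 * suc j) (m / 6)
                        ++ applyUpTo (λ j → 3 * (m / 6) + 2 + 3 * j) (m / 6)
... | no _ | no _ | yes _ = applyUpTo (λ j → 3 * suc j) (m / 6)
                        ++ applyUpTo (λ j → 3 * (m / 6) + 2 + 3 * j) (suc (m / 6))
... | no _ | no _ | no _ = []   -- m ≡ 0 (mod 3): not admissible

-- the i-th edge (1-indexed) of a list
nth : List Edge → ℕ → Maybe Edge
nth [] _ = nothing
nth (e ∷ es) zero = nothing
nth (e ∷ es) (suc zero) = just e
nth (e ∷ es) (suc (suc i)) = nth es (suc i)

pick : List Edge → List ℕ → List Edge
pick es [] = []
pick es (i ∷ is) with nth es i
... | just e = e ∷ pick es is
... | nothing = pick es is

deletedEdges : List ℕ → List Edge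
deletedEdges ps = concatMap (λ c → pick c (deletedPositions (length c))) (chains ps)

edgesG' : List ℕ → List Edge
edgesG' ps = filter (λ e → Data.Bool._≟_ (e ∈?E deletedEdges ps) false) (edgesG ps)

numEdgesG' : List ℕ → ℕ
numEdgesG' ps = length (edgesG' ps)

-- A chain with m ≢ 0 (mod 3) edges loses d(m) edges at strictly increasing interior positions,
-- so only backbone edges are deleted, no edge twice, and m + d(m) is odd exactly when
-- m ≡ 1 (mod 3); summed over all chains, Σ m + Σ d(m) ≡ t (mod 2). The backbone parts of the
-- chains concatenate to the b backbone edges of G_λ and every hanging edge lies in exactly two
-- chains, so Σ m ≡ b (mod 2). Deleting the Σ d(m) distinct edges from the b + s edges of G_λ
-- leaves e(G'_λ) = b + s − Σ d(m) ≡ t + s (mod 2).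

module Submission where

open import Defs
open import Data.Nat using (ℕ; zero; suc; pred; _+_; _*_; _∸_; _≤_; _<_; s≤s; z≤n; _%_; _/_; parity; NonZero; _≡ᵇ_)
open import Data.Maybe using (just; nothing)
open import Data.Nat.Properties
open import Data.Nat.DivMod using (m≡m%n+[m/n]*n; m%n<n; m∣n⇒o%n%m≡o%m)
open import Data.Nat.Divisibility using (_∣_; divides; m%n≡0⇒n∣m)
open import Data.Nat.Tactic.RingSolver using (solve-∀)
open import Algebra.Properties.CommutativeSemigroup +-commutativeSemigroup using (interchange; xy∙z≈xz∙y)
open import Data.Parity.Base as ℙ using (Parity; 0ℙ; 1ℙ; toSign)
import Data.Parity.Properties as ℙ
open import Data.Integer using (-1ℤ; _^_; _◃_; -_)
open import Data.Integer.Properties using (-1*i≡-i; neg-involutive)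
open import Data.Bool using (true; false; if_then_else_)
import Data.Bool as Bool
open import Data.List using (List; []; _∷_; _++_; [_]; length; applyUpTo; map; filter; concat; concatMap; deduplicate)
open import Data.Nat.ListAction using (sum)
open import Data.List.Relation.Binary.Sublist.Propositional using (_⊆_; []; _∷_; _∷ʳ_; minimum)
import Data.List.Relation.Binary.Sublist.Propositional.Properties as Sublist
open import Data.List.Properties
  using (length-++; length-applyUpTo; length-map; ++-identityʳ; concat-++; filter-accept; filter-reject)
open import Data.List.Relation.Unary.Linked.Properties using (Linked⇒AllPairs)
open import Data.List.Relation.Unary.All as All using (All; []; _∷_)
import Data.List.Relation.Unary.All.Properties as All
open import Data.List.Relation.Unary.AllPairs as AllPairs using (AllPairs; []; _∷_)
import Data.List.Relation.Unary.AllPairs.Properties as AllPairs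
open import Data.Product using (_×_; _,_; proj₁; proj₂; ∃)
open import Relation.Nullary using (¬_; yes; no; does; contradiction)
open import Relation.Nullary.Decidable using (dec-true; dec-false; ¬?; _×-dec_)
open import Relation.Unary using (Decidable)
open import Relation.Binary.PropositionalEquality hiding ([_])

parity-double : ∀ n → parity (n + n) ≡ 0ℙ
parity-double n = trans (ℙ.+-homo-+ n n) (ℙ.p+p≡0ℙ (parity n))

parity-odd : ∀ n → parity (suc (n + n)) ≡ 1ℙ
parity-odd n = trans (ℙ.+-homo-+ 1 (n + n)) (cong (1ℙ ℙ.+_) (parity-double n))

parity-+-double : ∀ m n → parity (m + (n + n)) ≡ parity m
parity-+-double m n =
  trans (ℙ.+-homo-+ m (n + n)) (trans (cong (parity m ℙ.+_) (parity-double n)) (ℙ.+-identityʳ (parity m)))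

-1^≡toSign-parity : ∀ n → -1ℤ ^ n ≡ toSign (parity n) ◃ 1
-1^≡toSign-parity zero = refl
-1^≡toSign-parity (suc zero) = refl
-1^≡toSign-parity (suc (suc n)) = begin
  -1ℤ ^ suc (suc n)     ≡⟨ -1*i≡-i _ ⟩
  - (-1ℤ ^ suc n)       ≡⟨ cong -_ (-1*i≡-i _) ⟩
  - - (-1ℤ ^ n)         ≡⟨ neg-involutive _ ⟩
  -1ℤ ^ n               ≡⟨ -1^≡toSign-parity n ⟩
  toSign (parity n) ◃ 1 ∎
  where open ≡-Reasoning

-1^-cong-parity : ∀ m n → parity m ≡ parity n → -1ℤ ^ m ≡ -1ℤ ^ n
-1^-cong-parity m n eq =
  trans (-1^≡toSign-parity m) (trans (cong (λ p → toSign p ◃ 1) eq) (sym (-1^≡toSign-parity n)))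

applyUpTo-++ : ∀ {A : Set} (f : ℕ → A) m n →
               applyUpTo f (m + n) ≡ applyUpTo f m ++ applyUpTo (λ i → f (m + i)) n
applyUpTo-++ f zero    n = refl
applyUpTo-++ f (suc m) n = cong (f 0 ∷_) (applyUpTo-++ (λ i → f (suc i)) m n)

applyUpTo-cong : ∀ {A : Set} {f g : ℕ → A} → (∀ i → f i ≡ g i) → ∀ n → applyUpTo f n ≡ applyUpTo g n
applyUpTo-cong f≗g zero    = refl
applyUpTo-cong f≗g (suc n) = cong₂ _∷_ (f≗g 0) (applyUpTo-cong (λ i → f≗g (suc i)) n)

filter-cong-All : ∀ {A : Set} {P Q : A → Set} (P? : Decidable P) (Q? : Decidable Q) {xs} →
                  All (λ x → does (P? x) ≡ does (Q? x)) xs → filter P? xs ≡ filter Q? xs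
filter-cong-All P? Q? []                      = refl
filter-cong-All P? Q? {x ∷ xs} (P≡Q ∷ P≡Qs) with does (P? x) | does (Q? x)
... | true  | true  = cong (x ∷_) (filter-cong-All P? Q? P≡Qs)
... | false | false = filter-cong-All P? Q? P≡Qs
... | true  | false = contradiction P≡Q λ ()
... | false | true  = contradiction P≡Q λ ()

length-concat : ∀ {A : Set} (xss : List (List A)) → length (concat xss) ≡ sum (map length xss)
length-concat []         = refl
length-concat (xs ∷ xss) = trans (length-++ xs) (cong (length xs +_) (length-concat xss))

deduplicate-increasing : ∀ {xs} → AllPairs _≤_ xs → AllPairs _<_ (deduplicate _≟_ xs)
deduplicate-increasing {[]}     []          = []
deduplicate-increasing {x ∷ xs} (x≤ ∷ inc) =
  All.zipWith (λ (x≤y , x≢y) → ≤∧≢⇒< x≤y x≢y)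
    (All.filter⁺ (λ y → ¬? (x ≟ y)) (All.deduplicate⁺ _≟_ x≤) ,
     All.all-filter (λ y → ¬? (x ≟ y)) (deduplicate _≟_ xs))
  ∷ AllPairs.filter⁺ (λ y → ¬? (x ≟ y)) (deduplicate-increasing inc)

-- Deleted positions

isOneMod3 : ℕ → Parity
isOneMod3 m = if does (m % 3 ≟ 1) then 1ℙ else 0ℙ

-- Positions are 1-based, as for nth: 1 < i < m avoids both end edges of a chain with m edges.
record ValidDeletion (m : ℕ) (is : List ℕ) (r : Parity) : Set where
  field
    increasing : AllPairs _<_ is
    interior   : All (λ i → 1 < i × i < m) is
    parity≡    : parity (m + length is) ≡ r

block₁ : ℕ → List ℕ
block₁ p = applyUpTo (λ j → 3 * suc j) p

block₂ : ℕ → ℕ → List ℕ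
block₂ p n = applyUpTo (λ j → 3 * p + 2 + 3 * j) n

block₁-increasing : ∀ p → AllPairs _<_ (block₁ p)
block₁-increasing p = AllPairs.applyUpTo⁺₁ _ p (λ i<j _ → *-monoʳ-< 3 (s≤s i<j))

block₁-bounds : ∀ p → All (λ i → 1 < i × i ≤ 3 * p) (block₁ p)
block₁-bounds p = All.applyUpTo⁺₁ _ p λ j<p →
  ≤-trans (s≤s (s≤s z≤n)) (*-monoʳ-≤ 3 (s≤s z≤n)) , *-monoʳ-≤ 3 j<p

block₂-increasing : ∀ p n → AllPairs _<_ (block₂ p n)
block₂-increasing p n = AllPairs.applyUpTo⁺₁ _ n (λ i<j _ → +-monoʳ-< (3 * p + 2) (*-monoʳ-< 3 i<j))

block₂-bounds : ∀ p n → All (λ i → 2 + 3 * p ≤ i × 3 + i ≤ 3 * p + 2 + 3 * n) (block₂ p n)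
block₂-bounds p n = All.applyUpTo⁺₁ _ n λ {j} j<n →
  ≤-trans (≤-reflexive (+-comm 2 (3 * p))) (m≤m+n _ _) ,
  ≤-trans (≤-reflexive (shift p j)) (+-monoʳ-≤ (3 * p + 2) (*-monoʳ-≤ 3 j<n))
  where
  shift : ∀ p j → 3 + (3 * p + 2 + 3 * j) ≡ 3 * p + 2 + 3 * suc j
  shift = solve-∀

-- For m = 6p + 1 and m = 6p + 4 the last position of block₂ is m − 2.
twoBlocks-valid : ∀ p n m → 3 * p + 2 + 3 * n ≡ suc m →
                  AllPairs _<_ (block₁ p ++ block₂ p n) × All (λ i → 1 < i × i < m) (block₁ p ++ block₂ p n)
twoBlocks-valid p n m end =
  AllPairs.++⁺ (block₁-increasing p) (block₂-increasing p n)
    (All.map (λ (_ , i≤3p) → All.map (λ (2+3p≤k , _) → ≤-<-trans i≤3p (≤-trans (n≤1+n _) 2+3p≤k))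
                                      (block₂-bounds p n))
             (block₁-bounds p)) ,
  All.++⁺ (All.map (λ (1<i , i≤3p) → 1<i , ≤-<-trans i≤3p 3p<m) (block₁-bounds p))
          (All.map (λ (2+3p≤i , 3+i≤) → ≤-trans (s≤s (s≤s z≤n)) 2+3p≤i ,
                                         ≤-trans (n≤1+n _) (≤-pred (≤-trans 3+i≤ (≤-reflexive end))))
                   (block₂-bounds p n))
  where
  3p<m : 3 * p < m
  3p<m = ≤-pred (≤-trans (≤-reflexive (+-comm 2 (3 * p)))
                         (≤-trans (m≤m+n (3 * p + 2) (3 * n)) (≤-reflexive end)))

length-blocks : ∀ p n → length (block₁ p ++ block₂ p n) ≡ p + n
length-blocks p n = trans (length-++ (block₁ p)) (cong₂ _+_ (length-applyUpTo _ p) (length-applyUpTo _ n))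

valid-2mod3 : ∀ q → ValidDeletion (2 + q * 3) (block₁ q) 0ℙ
valid-2mod3 q = record
  { increasing = block₁-increasing q
  ; interior   = All.map (λ (1<i , i≤3q) → 1<i , ≤-<-trans i≤3q 3q<m) (block₁-bounds q)
  ; parity≡    = begin
      parity (2 + q * 3 + length (block₁ q)) ≡⟨ cong (λ l → parity (2 + q * 3 + l)) (length-applyUpTo _ q) ⟩
      parity (2 + q * 3 + q)                 ≡⟨ cong parity (double q) ⟩
      parity (suc (q + q) + suc (q + q))     ≡⟨ parity-double (suc (q + q)) ⟩
      0ℙ                                     ∎
  }
  where
  open ≡-Reasoning
  3q<m : 3 * q < 2 + q * 3
  3q<m = ≤-<-trans (≤-reflexive (*-comm 3 q)) (n≤1+n _)
  double : ∀ q → 2 + q * 3 + q ≡ suc (q + q) + suc (q + q)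
  double = solve-∀

valid-1mod6 : ∀ p → ValidDeletion (1 + p * 6) (block₁ p ++ block₂ p p) 1ℙ
valid-1mod6 p = record
  { increasing = proj₁ blocks
  ; interior   = proj₂ blocks
  ; parity≡    = begin
      parity (1 + p * 6 + length (block₁ p ++ block₂ p p))
        ≡⟨ cong (λ l → parity (1 + p * 6 + l)) (length-blocks p p) ⟩
      parity (1 + p * 6 + (p + p))                         ≡⟨ cong parity (odd p) ⟩
      parity (suc (4 * p + 4 * p))                         ≡⟨ parity-odd (4 * p) ⟩
      1ℙ                                                   ∎
  }
  where
  open ≡-Reasoning
  end : ∀ p → 3 * p + 2 + 3 * p ≡ suc (1 + p * 6)
  end = solve-∀
  odd : ∀ p → 1 + p * 6 + (p + p) ≡ suc (4 * p + 4 * p)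
  odd = solve-∀
  blocks : AllPairs _<_ (block₁ p ++ block₂ p p) ×
           All (λ i → 1 < i × i < 1 + p * 6) (block₁ p ++ block₂ p p)
  blocks = twoBlocks-valid p p (1 + p * 6) (end p)

valid-4mod6 : ∀ p → ValidDeletion (4 + p * 6) (block₁ p ++ block₂ p (suc p)) 1ℙ
valid-4mod6 p = record
  { increasing = proj₁ blocks
  ; interior   = proj₂ blocks
  ; parity≡    = begin
      parity (4 + p * 6 + length (block₁ p ++ block₂ p (suc p)))
        ≡⟨ cong (λ l → parity (4 + p * 6 + l)) (length-blocks p (suc p)) ⟩
      parity (4 + p * 6 + (p + suc p))                           ≡⟨ cong parity (odd p) ⟩
      parity (suc ((2 + 4 * p) + (2 + 4 * p)))                   ≡⟨ parity-odd (2 + 4 * p) ⟩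
      1ℙ                                                         ∎
  }
  where
  open ≡-Reasoning
  end : ∀ p → 3 * p + 2 + 3 * suc p ≡ suc (4 + p * 6)
  end = solve-∀
  odd : ∀ p → 4 + p * 6 + (p + suc p) ≡ suc ((2 + 4 * p) + (2 + 4 * p))
  odd = solve-∀
  blocks : AllPairs _<_ (block₁ p ++ block₂ p (suc p)) ×
           All (λ i → 1 < i × i < 4 + p * 6) (block₁ p ++ block₂ p (suc p))
  blocks = twoBlocks-valid p (suc p) (4 + p * 6) (end p)

m≡r+[m/n]*n : ∀ m n .{{_ : NonZero n}} {r} → m % n ≡ r → m ≡ r + m / n * n
m≡r+[m/n]*n m n m%n≡r = trans (m≡m%n+[m/n]*n m n) (cong (_+ m / n * n) m%n≡r)

m%6%3≡m%3 : ∀ m → m % 6 % 3 ≡ m % 3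
m%6%3≡m%3 m = m∣n⇒o%n%m≡o%m 3 6 m (divides 2 refl)

3∣m-otherwise : ∀ m → m % 3 ≢ 2 → m % 6 ≢ 1 → m % 6 ≢ 4 → 3 ∣ m
3∣m-otherwise m ≢2 ≢1 ≢4 =
  m%n≡0⇒n∣m m 3 (trans (sym (m%6%3≡m%3 m)) (residue (m % 6) (m%n<n m 6) ≢2′ ≢1 ≢4))
  where
  ≢2′ : m % 6 % 3 ≢ 2
  ≢2′ eq = ≢2 (trans (sym (m%6%3≡m%3 m)) eq)
  residue : ∀ r → r < 6 → r % 3 ≢ 2 → r ≢ 1 → r ≢ 4 → r % 3 ≡ 0
  residue 0 _ _ _ _ = refl
  residue 1 _ _ ≢1 _ = contradiction refl ≢1
  residue 2 _ ≢2 _ _ = contradiction refl ≢2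
  residue 3 _ _ _ _ = refl
  residue 4 _ _ _ ≢4 = contradiction refl ≢4
  residue 5 _ ≢2 _ _ = contradiction refl ≢2
  residue (suc (suc (suc (suc (suc (suc _)))))) (s≤s (s≤s (s≤s (s≤s (s≤s (s≤s ())))))) _ _ _

deletedPositions-valid : ∀ m → ¬ 3 ∣ m → ValidDeletion m (deletedPositions m) (isOneMod3 m)
deletedPositions-valid m 3∤m with m % 3 ≟ 2 | m % 6 ≟ 1 | m % 6 ≟ 4
... | yes m%3≡2 | _ | _ rewrite m%3≡2 =
  subst (λ k → ValidDeletion k (block₁ (m / 3)) 0ℙ)
        (sym (m≡r+[m/n]*n m 3 m%3≡2)) (valid-2mod3 (m / 3))
... | no _ | yes m%6≡1 | _ rewrite trans (sym (m%6%3≡m%3 m)) (cong (_% 3) m%6≡1) =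
  subst (λ k → ValidDeletion k (block₁ (m / 6) ++ block₂ (m / 6) (m / 6)) 1ℙ)
        (sym (m≡r+[m/n]*n m 6 m%6≡1)) (valid-1mod6 (m / 6))
... | no _ | no _ | yes m%6≡4 rewrite trans (sym (m%6%3≡m%3 m)) (cong (_% 3) m%6≡4) =
  subst (λ k → ValidDeletion k (block₁ (m / 6) ++ block₂ (m / 6) (suc (m / 6))) 1ℙ)
        (sym (m≡r+[m/n]*n m 6 m%6≡4)) (valid-4mod6 (m / 6))
... | no ≢2 | no ≢1 | no ≢4 = contradiction (3∣m-otherwise m ≢2 ≢1 ≢4) 3∤m

deletedCount : ℕ → ℕ
deletedCount m = length (deletedPositions m)

isOneMod3-count : ∀ m ms → isOneMod3 m ℙ.+ parity (length (filter (λ k → k % 3 ≟ 1) ms))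
                          ≡ parity (length (filter (λ k → k % 3 ≟ 1) (m ∷ ms)))
-- does (m % 3 ≟ 1) computes to m % 3 ≡ᵇ 1, which is the term that with must abstract.
isOneMod3-count m ms with m % 3 ≡ᵇ 1
... | true  = sym (ℙ.+-homo-+ 1 (length (filter (λ k → k % 3 ≟ 1) ms)))
... | false = refl

chainLengths-parity : ∀ ms → All (λ m → ¬ 3 ∣ m) ms →
                      parity (sum ms + sum (map deletedCount ms)) ≡ parity (length (filter (λ k → k % 3 ≟ 1) ms))
chainLengths-parity []       []            = refl
chainLengths-parity (m ∷ ms) (3∤m ∷ 3∤ms) = begin
  parity (m + sum ms + (deletedCount m + sum (map deletedCount ms)))
    ≡⟨ cong parity (interchange m (sum ms) (deletedCount m) _) ⟩
  parity (m + deletedCount m + (sum ms + sum (map deletedCount ms)))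
    ≡⟨ ℙ.+-homo-+ (m + deletedCount m) _ ⟩
  parity (m + deletedCount m) ℙ.+ parity (sum ms + sum (map deletedCount ms))
    ≡⟨ cong₂ ℙ._+_ (ValidDeletion.parity≡ (deletedPositions-valid m 3∤m)) (chainLengths-parity ms 3∤ms) ⟩
  isOneMod3 m ℙ.+ parity (length (filter (λ k → k % 3 ≟ 1) ms))
    ≡⟨ isOneMod3-count m ms ⟩
  parity (length (filter (λ k → k % 3 ≟ 1) (m ∷ ms))) ∎
  where open ≡-Reasoning

nth-++ : ∀ es fs {i} → i ≤ length es → nth (es ++ fs) i ≡ nth es i
nth-++ []       []      z≤n = refl
nth-++ []       (_ ∷ _) z≤n = refl
nth-++ (e ∷ es) fs {zero}        _       = refl
nth-++ (e ∷ es) fs {suc zero}    _       = refl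
nth-++ (e ∷ es) fs {suc (suc i)} (s≤s i≤) = nth-++ es fs i≤

pick-++ : ∀ es fs is → All (_≤ length es) is → pick (es ++ fs) is ≡ pick es is
pick-++ es fs []       []          = refl
pick-++ es fs (i ∷ is) (i≤ ∷ is≤) rewrite nth-++ es fs i≤ with nth es i
... | just e  = cong (e ∷_) (pick-++ es fs is is≤)
... | nothing = pick-++ es fs is is≤

pick-∷ : ∀ e es is → All (2 ≤_) is → pick (e ∷ es) is ≡ pick es (map pred is)
pick-∷ e es []                  []           = refl
pick-∷ e es (suc (suc i) ∷ is) (s≤s (s≤s _) ∷ 2≤is) with nth es (suc i)
... | just f  = cong (f ∷_) (pick-∷ e es is 2≤is)
... | nothing = pick-∷ e es is 2≤is

map-pred-increasing : ∀ {is} → All (1 ≤_) is → AllPairs _<_ is → AllPairs _<_ (map pred is)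
map-pred-increasing []             []           = []
map-pred-increasing (s≤s _ ∷ 1≤is) (i< ∷ inc) =
  All.map⁺ (All.map (λ { {suc _} (s≤s i<j) → i<j }) i<) ∷ map-pred-increasing 1≤is inc

nth-in-range : ∀ es {i} → 1 ≤ i × i ≤ length es → ∃ λ e → nth es i ≡ just e
nth-in-range (e ∷ es) {1}           _                       = e , refl
nth-in-range (e ∷ es) {suc (suc i)} (_ , s≤s i≤)           = nth-in-range es (s≤s z≤n , i≤)

map-pred-bounds : ∀ {n is} → All (λ i → 2 ≤ i × i ≤ suc n) is → All (λ i → 1 ≤ i × i ≤ n) (map pred is)
map-pred-bounds []                          = []
map-pred-bounds ((s≤s 1≤i , s≤s i≤n) ∷ bs) = (1≤i , i≤n) ∷ map-pred-bounds bs

pick-tail-⊆ : ∀ e es is → AllPairs _<_ is → All (λ i → 2 ≤ i × i ≤ suc (length es)) is →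
              pick (e ∷ es) is ⊆ es

pick-⊆ : ∀ es is → AllPairs _<_ is → All (λ i → 1 ≤ i × i ≤ length es) is → pick es is ⊆ es
pick-⊆ es       []                 _          _                 = minimum es
pick-⊆ []       (i ∷ is)           _          ((1≤i , i≤0) ∷ _) = contradiction (≤-trans 1≤i i≤0) λ ()
pick-⊆ (e ∷ es) (0 ∷ is)           _          ((() , _) ∷ _)
pick-⊆ (e ∷ es) (1 ∷ is)           (1< ∷ inc) (_ ∷ bounds)      =
  refl ∷ pick-tail-⊆ e es is inc (All.zipWith (λ (1<i , (_ , i≤)) → 1<i , i≤) (1< , bounds))
pick-⊆ (e ∷ es) (suc (suc i) ∷ is) (i< ∷ inc) ((_ , i≤) ∷ bounds) =
  e ∷ʳ pick-tail-⊆ e es (suc (suc i) ∷ is) (i< ∷ inc)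
         ((s≤s (s≤s z≤n) , i≤) ∷
          All.zipWith (λ (i<j , (_ , j≤)) → ≤-trans (s≤s (s≤s z≤n)) (<⇒≤ i<j) , j≤) (i< , bounds))

pick-tail-⊆ e es is inc bounds =
  subst (_⊆ es) (sym (pick-∷ e es is (All.map proj₁ bounds)))
    (pick-⊆ es (map pred is) (map-pred-increasing (All.map (λ (2≤i , _) → ≤-trans (s≤s z≤n) 2≤i) bounds) inc)
      (map-pred-bounds bounds))

length-pick : ∀ es is → All (λ i → 1 ≤ i × i ≤ length es) is → length (pick es is) ≡ length is
length-pick es []       []               = refl
length-pick es (i ∷ is) (i-in ∷ bounds) with nth es i | nth-in-range es i-in
... | just _ | _  = cong suc (length-pick es is bounds)
... | nothing | _ , ()

-- Chains

data IsBackbone : Edge → Set where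
  backbone : ∀ v → IsBackbone (backbone v)

data Cap : List Edge → Set where
  none : Cap []
  hang : ∀ v → Cap [ hanging v ]

data Chain : List Edge → Set where
  chain : ∀ {p mid q} → Cap p → All IsBackbone mid → Cap q → Chain (p ++ mid ++ q)

backbones : List Edge → List Edge
backbones []                = []
backbones (backbone v ∷ es) = backbone v ∷ backbones es
backbones (hanging v ∷ es)  = backbones es

hangingCount : List Edge → ℕ
hangingCount []                = 0
hangingCount (backbone v ∷ es) = hangingCount es
hangingCount (hanging v ∷ es)  = suc (hangingCount es)

length≡backbones+hangingCount : ∀ es → length es ≡ length (backbones es) + hangingCount es
length≡backbones+hangingCount []                = refl
length≡backbones+hangingCount (backbone v ∷ es) = cong suc (length≡backbones+hangingCount es)
length≡backbones+hangingCount (hanging v ∷ es)  =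
  trans (cong suc (length≡backbones+hangingCount es)) (sym (+-suc _ _))

backbones-++ : ∀ es fs → backbones (es ++ fs) ≡ backbones es ++ backbones fs
backbones-++ []                fs = refl
backbones-++ (backbone v ∷ es) fs = cong (backbone v ∷_) (backbones-++ es fs)
backbones-++ (hanging v ∷ es)  fs = backbones-++ es fs

hangingCount-++ : ∀ es fs → hangingCount (es ++ fs) ≡ hangingCount es + hangingCount fs
hangingCount-++ []                fs = refl
hangingCount-++ (backbone v ∷ es) fs = hangingCount-++ es fs
hangingCount-++ (hanging v ∷ es)  fs = cong suc (hangingCount-++ es fs)

backbones-all : ∀ {es} → All IsBackbone es → backbones es ≡ es
backbones-all []                = refl
backbones-all (backbone v ∷ bs) = cong (backbone v ∷_) (backbones-all bs)

hangingCount-all : ∀ {es} → All IsBackbone es → hangingCount es ≡ 0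
hangingCount-all []                = refl
hangingCount-all (backbone v ∷ bs) = hangingCount-all bs

backbones-cap : ∀ {p} → Cap p → backbones p ≡ []
backbones-cap none     = refl
backbones-cap (hang v) = refl

backbones-chain : ∀ {p mid q} → Cap p → All IsBackbone mid → Cap q → backbones (p ++ mid ++ q) ≡ mid
backbones-chain {p} {mid} {q} cp bm cq = begin
  backbones (p ++ mid ++ q)              ≡⟨ backbones-++ p (mid ++ q) ⟩
  backbones p ++ backbones (mid ++ q)    ≡⟨ cong₂ _++_ (backbones-cap cp) (backbones-++ mid q) ⟩
  backbones mid ++ backbones q           ≡⟨ cong₂ _++_ (backbones-all bm) (backbones-cap cq) ⟩
  mid ++ []                              ≡⟨ ++-identityʳ mid ⟩
  mid                                    ∎
  where open ≡-Reasoning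

length-cap : ∀ {q} → Cap q → ∀ n → n + length q ≤ suc n
length-cap none     n = ≤-trans (≤-reflexive (+-identityʳ n)) (n≤1+n n)
length-cap (hang v) n = ≤-reflexive (+-comm n 1)

below-cap : ∀ mid {q i} → Cap q → i < length (mid ++ q) → i ≤ length mid
below-cap mid cq i< = ≤-pred (≤-trans i< (≤-trans (≤-reflexive (length-++ mid)) (length-cap cq (length mid))))

-- Interior positions never fall on the hanging end edges of a chain.
pick-interior-⊆ : ∀ {c is} → Chain c → AllPairs _<_ is → All (λ i → 1 < i × i < length c) is →
                  pick c is ⊆ backbones c
pick-interior-⊆ {is = is} (chain {p} {mid} {q} cp bm cq) inc interior
  rewrite backbones-chain cp bm cq = from-cap cp interior
  where
  from-cap : ∀ {p} → Cap p → All (λ i → 1 < i × i < length (p ++ mid ++ q)) is → pick (p ++ mid ++ q) is ⊆ mid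
  from-cap none int =
    subst (_⊆ mid) (sym (pick-++ mid q is (All.map proj₂ bounds))) (pick-⊆ mid is inc bounds)
    where
    bounds : All (λ i → 1 ≤ i × i ≤ length mid) is
    bounds = All.map (λ (1<i , i<) → <⇒≤ 1<i , below-cap mid cq i<) int
  from-cap (hang v) int =
    subst (_⊆ mid) (sym (trans (pick-∷ (hanging v) (mid ++ q) is (All.map proj₁ int))
                               (pick-++ mid q (map pred is) (All.map proj₂ bounds))))
      (pick-⊆ mid (map pred is) (map-pred-increasing (All.map (λ (1<i , _) → <⇒≤ 1<i) int) inc) bounds)
    where
    bounds : All (λ i → 1 ≤ i × i ≤ length mid) (map pred is)
    bounds = map-pred-bounds
      (All.map (λ { {zero} (() , _) ; {suc _} (1<i , s≤s i<) → 1<i , s≤s (below-cap mid cq i<) }) int)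

deletedIn : List Edge → List Edge
deletedIn c = pick c (deletedPositions (length c))

deletedIn-⊆ : ∀ {c} → Chain c → ¬ 3 ∣ length c → deletedIn c ⊆ backbones c
deletedIn-⊆ {c} ch 3∤c = pick-interior-⊆ ch increasing interior
  where open ValidDeletion (deletedPositions-valid (length c) 3∤c)

length-deletedIn : ∀ c → ¬ 3 ∣ length c → length (deletedIn c) ≡ deletedCount (length c)
length-deletedIn c 3∤c = length-pick c _ (All.map (λ (1<i , i<c) → <⇒≤ 1<i , <⇒≤ i<c) interior)
  where open ValidDeletion (deletedPositions-valid (length c) 3∤c)

deletedIn-concat-⊆ : ∀ {cs} → All Chain cs → All (λ c → ¬ 3 ∣ length c) cs →
                     concatMap deletedIn cs ⊆ backbones (concat cs)
deletedIn-concat-⊆ []                     []            = []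
deletedIn-concat-⊆ {c ∷ cs} (ch ∷ chs) (3∤c ∷ 3∤cs) =
  subst (concatMap deletedIn (c ∷ cs) ⊆_) (sym (backbones-++ c (concat cs)))
    (Sublist.++⁺ (deletedIn-⊆ ch 3∤c) (deletedIn-concat-⊆ chs 3∤cs))

length-concatMap-deletedIn : ∀ cs → All (λ c → ¬ 3 ∣ length c) cs →
                             length (concatMap deletedIn cs) ≡ sum (map deletedCount (map length cs))
length-concatMap-deletedIn []       []            = refl
length-concatMap-deletedIn (c ∷ cs) (3∤c ∷ 3∤cs) =
  trans (length-++ (deletedIn c)) (cong₂ _+_ (length-deletedIn c 3∤c) (length-concatMap-deletedIn cs 3∤cs))

-- Chain decompositions of backbone segments

bb-backbone : ∀ a b → All IsBackbone (bb a b)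
bb-backbone a b = All.applyUpTo⁺₂ _ (b ∸ a) (λ i → backbone (a + i))

bb-++ : ∀ {a b c} → a ≤ b → b ≤ c → bb a b ++ bb b c ≡ bb a c
bb-++ {a} {b} {c} a≤b b≤c = begin
  bb a b ++ bb b c
    ≡⟨ cong (bb a b ++_) (applyUpTo-cong (λ i → cong backbone (shift i)) (c ∸ b)) ⟩
  bb a b ++ applyUpTo (λ i → backbone (a + ((b ∸ a) + i))) (c ∸ b)
    ≡⟨ sym (applyUpTo-++ (λ i → backbone (a + i)) (b ∸ a) (c ∸ b)) ⟩
  applyUpTo (λ i → backbone (a + i)) ((b ∸ a) + (c ∸ b))
    ≡⟨ cong (applyUpTo (λ i → backbone (a + i))) length≡ ⟩
  bb a c ∎
  where
  open ≡-Reasoning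
  shift : ∀ i → b + i ≡ a + ((b ∸ a) + i)
  shift i = trans (cong (_+ i) (sym (m+[n∸m]≡n a≤b))) (+-assoc a (b ∸ a) i)
  length≡ : (b ∸ a) + (c ∸ b) ≡ c ∸ a
  length≡ = sym (trans (cong (_∸ a) (sym a+≡c)) (m+n∸m≡n a _))
    where
    a+≡c : a + ((b ∸ a) + (c ∸ b)) ≡ c
    a+≡c = trans (sym (+-assoc a (b ∸ a) (c ∸ b)))
                 (trans (cong (_+ (c ∸ b)) (m+[n∸m]≡n a≤b)) (m+[n∸m]≡n b≤c))

bb-empty : ∀ a → bb a a ≡ []
bb-empty a = cong (applyUpTo _) (n∸n≡0 a)

bb-single : ∀ a → bb a (suc a) ≡ backbone a ∷ []
bb-single a = trans (cong (applyUpTo _) (m+n∸n≡m 1 a)) (cong (λ v → backbone v ∷ []) (+-identityʳ a))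

bb-step : ∀ {a b} → a < b → bb a b ≡ backbone a ∷ bb (suc a) b
bb-step {a} {b} a<b = trans (sym (bb-++ (n≤1+n a) a<b)) (cong (_++ bb (suc a) b) (bb-single a))

record ChainDecomposition (cs : List (List Edge)) (mid : List Edge) (r : Parity) : Set where
  field
    shaped        : All Chain cs
    backbones≡    : backbones (concat cs) ≡ mid
    hangingParity : parity (hangingCount (concat cs)) ≡ r

decomposition-[_] : ∀ {c mid h} → Chain c → backbones c ≡ mid → hangingCount c ≡ h →
                    ChainDecomposition [ c ] mid (parity h)
decomposition-[_] {c} ch bb≡ hc≡ = record
  { shaped        = ch ∷ []
  ; backbones≡    = trans (cong backbones (++-identityʳ c)) bb≡
  ; hangingParity = cong parity (trans (cong hangingCount (++-identityʳ c)) hc≡)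
  }

decomposition-++ : ∀ {cs ds mid mid′ r r′} → ChainDecomposition cs mid r → ChainDecomposition ds mid′ r′ →
                   ChainDecomposition (cs ++ ds) (mid ++ mid′) (r ℙ.+ r′)
decomposition-++ {cs} {ds} dcs dds = record
  { shaped        = All.++⁺ (shaped dcs) (shaped dds)
  ; backbones≡    = trans (cong backbones (sym (concat-++ cs ds)))
                      (trans (backbones-++ (concat cs) (concat ds)) (cong₂ _++_ (backbones≡ dcs) (backbones≡ dds)))
  ; hangingParity = trans (cong (λ es → parity (hangingCount es)) (sym (concat-++ cs ds)))
                      (trans (cong parity (hangingCount-++ (concat cs) (concat ds)))
                        (trans (ℙ.+-homo-+ (hangingCount (concat cs)) _)
                               (cong₂ ℙ._+_ (hangingParity dcs) (hangingParity dds))))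
  }
  where open ChainDecomposition

decomposition-parity : ∀ {cs mid r} → ChainDecomposition cs mid r →
                       parity (sum (map length cs)) ≡ parity (length mid) ℙ.+ r
decomposition-parity {cs} {mid} dcs = begin
  parity (sum (map length cs))                                          ≡⟨ cong parity (sym (length-concat cs)) ⟩
  parity (length (concat cs))
    ≡⟨ cong parity (length≡backbones+hangingCount (concat cs)) ⟩
  parity (length (backbones (concat cs)) + hangingCount (concat cs))
    ≡⟨ ℙ.+-homo-+ (length (backbones (concat cs))) _ ⟩
  parity (length (backbones (concat cs))) ℙ.+ parity (hangingCount (concat cs))
    ≡⟨ cong₂ (λ es p → parity (length es) ℙ.+ p) backbones≡ hangingParity ⟩
  parity (length mid) ℙ.+ _                                             ∎
  where
  open ≡-Reasoning
  open ChainDecomposition dcs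

hangingCount-middle : ∀ {mid} → All IsBackbone mid → ∀ q → hangingCount (mid ++ q) ≡ hangingCount q
hangingCount-middle {mid} bm q = trans (hangingCount-++ mid q) (cong (_+ hangingCount q) (hangingCount-all bm))

laterChains-decomposition : ∀ n a r → a ≤ n → AllPairs _<_ (a ∷ r) → All (_≤ n) r →
                            ChainDecomposition (laterChains n a r) (bb a n) 1ℙ
laterChains-decomposition n a [] a≤n _ _ =
  decomposition-[ subst Chain (cong (hanging a ∷_) (++-identityʳ (bb a n))) (chain (hang a) bm none) ]
    (backbones-all bm) (cong suc (hangingCount-all bm))
  where
  bm : All IsBackbone (bb a n)
  bm = bb-backbone a n
laterChains-decomposition n a (b ∷ r) a≤n ((a<b ∷ _) ∷ inc) (b≤n ∷ r≤n) =
  subst (λ mid → ChainDecomposition (laterChains n a (b ∷ r)) mid 1ℙ) (bb-++ (<⇒≤ a<b) b≤n)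
    (decomposition-++ (decomposition-[ chain (hang a) bm (hang b) ] (backbones-chain (hang a) bm (hang b))
                                       (cong suc (hangingCount-middle bm [ hanging b ])))
                      (laterChains-decomposition n b r b≤n inc r≤n))
  where
  bm : All IsBackbone (bb a b)
  bm = bb-backbone a b

componentChains-decomposition : ∀ k n as → k ≤ n → AllPairs _<_ as → All (λ a → k ≤ a × a ≤ n) as →
                                ChainDecomposition (componentChains k n as) (bb k n) 0ℙ
componentChains-decomposition k n [] k≤n _ _ =
  decomposition-[ subst Chain (++-identityʳ (bb k n)) (chain none bm none) ] (backbones-all bm) (hangingCount-all bm)
  where
  bm : All IsBackbone (bb k n)
  bm = bb-backbone k n
componentChains-decomposition k n (a ∷ as) k≤n inc ((k≤a , a≤n) ∷ bounds) =
  subst (λ mid → ChainDecomposition (componentChains k n (a ∷ as)) mid 0ℙ) (bb-++ k≤a a≤n)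
    (decomposition-++ (decomposition-[ chain none bm (hang a) ] (backbones-chain none bm (hang a))
                                       (hangingCount-middle bm [ hanging a ]))
                      (laterChains-decomposition n a as a≤n inc (All.map proj₂ bounds)))
  where
  bm : All IsBackbone (bb k a)
  bm = bb-backbone k a

-- Components

∈?ℕ-here : ∀ v ws → (v ∈?ℕ (v ∷ ws)) ≡ true
∈?ℕ-here v ws = cong (λ b → if b then true else (v ∈?ℕ ws)) (dec-true (v ≟ v) refl)

∈?ℕ-there : ∀ {v w} ws → v ≢ w → (v ∈?ℕ (w ∷ ws)) ≡ (v ∈?ℕ ws)
∈?ℕ-there {v} {w} ws v≢w = cong (λ b → if b then true else (v ∈?ℕ ws)) (dec-false (v ≟ w) v≢w)

∈?ℕ-absent : ∀ {v ws} → All (v ≢_) ws → (v ∈?ℕ ws) ≡ false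
∈?ℕ-absent {ws = []}     []             = refl
∈?ℕ-absent {ws = w ∷ ws} (v≢w ∷ v≢ws) = trans (∈?ℕ-there ws v≢w) (∈?ℕ-absent v≢ws)

HasSuccessorIn : List ℕ → ℕ → Set
HasSuccessorIn U v = (suc v ∈?ℕ U) ≡ true

hasSuccessorIn? : ∀ U → Decidable (HasSuccessorIn U)
hasSuccessorIn? U v = (suc v ∈?ℕ U) Bool.≟ true

hasSuccessorIn-∷ : ∀ {x} U → All (x <_) U → filter (hasSuccessorIn? (x ∷ U)) U ≡ filter (hasSuccessorIn? U) U
hasSuccessorIn-∷ {x} U x<U = filter-cong-All (hasSuccessorIn? (x ∷ U)) (hasSuccessorIn? U)
  (All.map (λ {v} x<v → cong (λ b → does (b Bool.≟ true)) (∈?ℕ-there U (λ eq → <⇒≢ (<-trans x<v (n<1+n v)) (sym eq))))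
           x<U)

no-successor : ∀ {U x} → All (suc x ≢_) U → ¬ HasSuccessorIn U x
no-successor sx≢U eq = contradiction (trans (sym (∈?ℕ-absent sx≢U)) eq) λ ()

suc≢self : ∀ x → suc x ≢ x
suc≢self x eq = <⇒≢ (n<1+n x) (sym eq)

bbRun : ℕ × ℕ → List Edge
bbRun (k , n) = bb k n

runs-head : ∀ x xs → ∃ λ n → ∃ λ rs → runs (x ∷ xs) ≡ (x , n) ∷ rs
runs-head x xs with runs xs
... | [] = x , [] , refl
... | (k , n) ∷ rs with k ≟ suc x
...   | yes _ = n , rs , refl
...   | no _  = x , (k , n) ∷ rs , refl

runs-backbone : ∀ U → AllPairs _<_ U →
                All (λ (k , n) → k ≤ n) (runs U) ×
                concatMap bbRun (runs U) ≡ map backbone (filter (hasSuccessorIn? U) U)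
runs-backbone [] [] = [] , refl
runs-backbone (x ∷ []) _ = (≤-refl ∷ []) ,
  trans (cong (_++ []) (bb-empty x))
        (cong (map backbone) (sym (filter-reject (hasSuccessorIn? (x ∷ [])) (no-successor (suc≢self x ∷ [])))))
runs-backbone (x ∷ y ∷ ys) (x< ∷ inc@(y< ∷ _)) with runs-backbone (y ∷ ys) inc | runs-head y ys
... | ok , cover | n , rs , eq rewrite eq with y ≟ suc x
...   | yes refl = (≤-trans (n≤1+n x) (All.head ok) ∷ All.tail ok) , (begin
  bb x n ++ R                                                 ≡⟨ cong (_++ R) (bb-step (All.head ok)) ⟩
  backbone x ∷ (bb (suc x) n ++ R)                            ≡⟨ cong (backbone x ∷_) cover ⟩
  backbone x ∷ map backbone (filter (hasSuccessorIn? U) U)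
    ≡⟨ cong (λ l → backbone x ∷ map backbone l) (sym (hasSuccessorIn-∷ U x<)) ⟩
  map backbone (x ∷ filter (hasSuccessorIn? (x ∷ U)) U)
    ≡⟨ cong (map backbone) (sym (filter-accept (hasSuccessorIn? (x ∷ U)) x-succ)) ⟩
  map backbone (filter (hasSuccessorIn? (x ∷ U)) (x ∷ U))     ∎)
  where
  open ≡-Reasoning
  U : List ℕ
  U = suc x ∷ ys
  R : List Edge
  R = concatMap bbRun rs
  x-succ : HasSuccessorIn (x ∷ U) x
  x-succ = trans (∈?ℕ-there U (suc≢self x)) (∈?ℕ-here (suc x) ys)
...   | no y≢sx = (≤-refl ∷ ok) , (begin
  bb x x ++ R                                                 ≡⟨ cong (_++ R) (bb-empty x) ⟩
  R                                                           ≡⟨ cover ⟩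
  map backbone (filter (hasSuccessorIn? U) U)                 ≡⟨ cong (map backbone) (sym (hasSuccessorIn-∷ U x<)) ⟩
  map backbone (filter (hasSuccessorIn? (x ∷ U)) U)
    ≡⟨ cong (map backbone) (sym (filter-reject (hasSuccessorIn? (x ∷ U)) (no-successor sx∉))) ⟩
  map backbone (filter (hasSuccessorIn? (x ∷ U)) (x ∷ U))     ∎)
  where
  open ≡-Reasoning
  U : List ℕ
  U = y ∷ ys
  R : List Edge
  R = concatMap bbRun ((y , n) ∷ rs)
  sx<y : suc x < y
  sx<y = ≤∧≢⇒< (All.head x<) (λ eq → y≢sx (sym eq))
  sx∉ : All (suc x ≢_) (x ∷ U)
  sx∉ = suc≢self x ∷ (λ eq → y≢sx (sym eq)) ∷ All.map (λ y<z → <⇒≢ (<-trans sx<y y<z)) y<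

-- The local function comp of chains.
component : List ℕ → ℕ × ℕ → List (List Edge)
component D (k , n) = componentChains k n (filter (λ a → (k ≤? a) ×-dec (a ≤? n)) D)

runs-decomposition : ∀ {D} → AllPairs _<_ D → ∀ rs → All (λ (k , n) → k ≤ n) rs →
                     ChainDecomposition (concatMap (component D) rs) (concatMap bbRun rs) 0ℙ
runs-decomposition D-inc []             []          = record { shaped = [] ; backbones≡ = refl ; hangingParity = refl }
runs-decomposition {D} D-inc ((k , n) ∷ rs) (k≤n ∷ ok) =
  decomposition-++ (componentChains-decomposition k n _ k≤n (AllPairs.filter⁺ inRun? D-inc) (All.all-filter inRun? D))
                   (runs-decomposition D-inc rs ok)
  where
  inRun? : Decidable (λ a → k ≤ a × a ≤ n)
  inRun? a = (k ≤? a) ×-dec (a ≤? n)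

successors : List ℕ → List ℕ
successors ps = filter (hasSuccessorIn? (μ₁ ps)) (μ₁ ps)

μ₁-increasing : ∀ {ps} → IsPartition ps → AllPairs _<_ (μ₁ ps)
μ₁-increasing partition = deduplicate-increasing (Linked⇒AllPairs ≤-trans (IsPartition.sorted partition))

μ₂-increasing : ∀ {ps} → IsPartition ps → AllPairs _<_ (μ₂ ps)
μ₂-increasing partition = AllPairs.filter⁺ _ (μ₁-increasing partition)

chains-decomposition : ∀ {ps} → IsPartition ps → ChainDecomposition (chains ps) (map backbone (successors ps)) 0ℙ
chains-decomposition {ps} partition
  with ok , cover ← runs-backbone (μ₁ ps) (μ₁-increasing partition) =
  subst (λ mid → ChainDecomposition (chains ps) mid 0ℙ) cover
    (runs-decomposition (μ₂-increasing partition) (runs (μ₁ ps)) ok)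

-- Counting the edges of G′_λ

∈?E-here : ∀ e es → (e ∈?E (e ∷ es)) ≡ true
∈?E-here e es = cong (λ b → if b then true else (e ∈?E es)) (dec-true (e ≟E e) refl)

∈?E-there : ∀ {e f} es → e ≢ f → (e ∈?E (f ∷ es)) ≡ (e ∈?E es)
∈?E-there {e} {f} es e≢f = cong (λ b → if b then true else (e ∈?E es)) (dec-false (e ≟E f) e≢f)

∈?E-absent : ∀ {e es} → All (e ≢_) es → (e ∈?E es) ≡ false
∈?E-absent {es = []}     []             = refl
∈?E-absent {es = f ∷ es} (e≢f ∷ e≢es) = trans (∈?E-there es e≢f) (∈?E-absent e≢es)

NotIn : List Edge → Edge → Set
NotIn X e = (e ∈?E X) ≡ false

notIn? : ∀ X → Decidable (NotIn X)
notIn? X e = (e ∈?E X) Bool.≟ false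

filter-notIn-∷ : ∀ {y} X L → All (y ≢_) L → filter (notIn? (y ∷ X)) (y ∷ L) ≡ filter (notIn? X) L
filter-notIn-∷ {y} X L y≢L =
  trans (filter-reject (notIn? (y ∷ X)) (λ eq → contradiction (trans (sym (∈?E-here y X)) eq) λ ()))
        (filter-cong-All (notIn? (y ∷ X)) (notIn? X)
          (All.map (λ y≢z → cong (λ b → does (b Bool.≟ false)) (∈?E-there X (λ eq → y≢z (sym eq)))) y≢L))

length-filter-notIn : ∀ {L X} → AllPairs _≢_ L → X ⊆ L → length (filter (notIn? X) L) + length X ≡ length L
length-filter-notIn [] [] = refl
length-filter-notIn {y ∷ L} {X} (y≢L ∷ distinct) (.y ∷ʳ X⊆L) =
  trans (cong (λ l → length l + length X) (filter-accept (notIn? X) (∈?E-absent (Sublist.All-resp-⊆ X⊆L y≢L))))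
        (cong suc (length-filter-notIn distinct X⊆L))
length-filter-notIn {y ∷ L} {.y ∷ X} (y≢L ∷ distinct) (refl ∷ X⊆L) = begin
  length (filter (notIn? (y ∷ X)) (y ∷ L)) + suc (length X)
    ≡⟨ cong (λ l → length l + suc (length X)) (filter-notIn-∷ X L y≢L) ⟩
  length (filter (notIn? X) L) + suc (length X)             ≡⟨ +-suc _ (length X) ⟩
  suc (length (filter (notIn? X) L) + length X)             ≡⟨ cong suc (length-filter-notIn distinct X⊆L) ⟩
  suc (length L)                                            ∎
  where open ≡-Reasoning

deletedEdges-⊆ : ∀ {ps} → IsPartition ps → Admissible ps → deletedEdges ps ⊆ map backbone (successors ps)
deletedEdges-⊆ {ps} partition admissible =
  subst (deletedEdges ps ⊆_) backbones≡ (deletedIn-concat-⊆ shaped (All.map⁻ admissible))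
  where open ChainDecomposition (chains-decomposition partition)

map-distinct : ∀ {A : Set} {vs} (f : ℕ → A) → (∀ {v w} → f v ≡ f w → v ≡ w) →
               AllPairs _<_ vs → AllPairs _≢_ (map f vs)
map-distinct f f-injective inc = AllPairs.map⁺ (AllPairs.map (λ v<w eq → <⇒≢ v<w (f-injective eq)) inc)

edgesG-distinct : ∀ {ps} → IsPartition ps → AllPairs _≢_ (edgesG ps)
edgesG-distinct {ps} partition =
  AllPairs.++⁺ (map-distinct backbone (λ { refl → refl }) (AllPairs.filter⁺ _ (μ₁-increasing partition)))
               (map-distinct hanging (λ { refl → refl }) (μ₂-increasing partition))
               (All.map⁺ (All.universal (λ _ → All.map⁺ (All.universal (λ _ ()) (μ₂ ps))) (successors ps)))

numEdgesG'+deleted : ∀ {ps} → IsPartition ps → Admissible ps →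
                     numEdgesG' ps + length (deletedEdges ps) ≡ length (successors ps) + length (μ₂ ps)
numEdgesG'+deleted {ps} partition admissible = begin
  numEdgesG' ps + length (deletedEdges ps)                             ≡⟨ removal ⟩
  length (edgesG ps)                                                   ≡⟨ length-++ (map backbone (successors ps)) ⟩
  length (map backbone (successors ps)) + length (map hanging (μ₂ ps)) ≡⟨ cong₂ _+_ (length-map backbone (successors ps))
                                                                                     (length-map hanging (μ₂ ps)) ⟩
  length (successors ps) + length (μ₂ ps)                              ∎
  where
  open ≡-Reasoning
  removal : numEdgesG' ps + length (deletedEdges ps) ≡ length (edgesG ps)
  removal = length-filter-notIn (edgesG-distinct partition) (Sublist.++⁺ʳ _ (deletedEdges-⊆ partition admissible))

SIG-sum-parity : ∀ {ps} → IsPartition ps → parity (sum (SIG ps)) ≡ parity (length (successors ps))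
SIG-sum-parity {ps} partition =
  trans (decomposition-parity (chains-decomposition partition))
        (trans (ℙ.+-identityʳ _) (cong parity (length-map backbone (successors ps))))

chainsOneMod3-parity : ∀ {ps} → IsPartition ps → Admissible ps →
                       parity (length (filter (λ m → m % 3 ≟ 1) (SIG ps)))
                         ≡ parity (length (successors ps) + length (deletedEdges ps))
chainsOneMod3-parity {ps} partition admissible = begin
  parity (length (filter (λ m → m % 3 ≟ 1) (SIG ps)))          ≡⟨ sym (chainLengths-parity (SIG ps) admissible) ⟩
  parity (sum (SIG ps) + sum (map deletedCount (SIG ps)))       ≡⟨ cong (λ n → parity (sum (SIG ps) + n)) deleted≡ ⟩
  parity (sum (SIG ps) + length (deletedEdges ps))              ≡⟨ ℙ.+-homo-+ (sum (SIG ps)) _ ⟩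
  parity (sum (SIG ps)) ℙ.+ parity (length (deletedEdges ps))
                                                                ≡⟨ cong (ℙ._+ parity (length (deletedEdges ps))) (SIG-sum-parity partition) ⟩
  parity (length (successors ps)) ℙ.+ parity (length (deletedEdges ps))
                                                                ≡⟨ sym (ℙ.+-homo-+ (length (successors ps)) _) ⟩
  parity (length (successors ps) + length (deletedEdges ps))    ∎
  where
  open ≡-Reasoning
  deleted≡ : sum (map deletedCount (SIG ps)) ≡ length (deletedEdges ps)
  deleted≡ = sym (length-concatMap-deletedIn (chains ps) (All.map⁻ admissible))

sign-parity : ∀ t b d e x → parity t ≡ parity (b + x) → e + x ≡ b + d → parity (t + d) ≡ parity e
sign-parity t b d e x t≡b+x e+x≡b+d = begin
  parity (t + d)              ≡⟨ ℙ.+-homo-+ t d ⟩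
  parity t ℙ.+ parity d       ≡⟨ cong (ℙ._+ parity d) t≡b+x ⟩
  parity (b + x) ℙ.+ parity d ≡⟨ sym (ℙ.+-homo-+ (b + x) d) ⟩
  parity (b + x + d)          ≡⟨ cong parity (xy∙z≈xz∙y b x d) ⟩
  parity (b + d + x)          ≡⟨ cong (λ y → parity (y + x)) (sym e+x≡b+d) ⟩
  parity (e + x + x)          ≡⟨ cong parity (+-assoc e x x) ⟩
  parity (e + (x + x))        ≡⟨ parity-+-double e x ⟩
  parity e                    ∎
  where open ≡-Reasoning

proposition5p3 : (ps : List ℕ) → IsPartition ps → Neighborly ps → Admissible ps →
                 sign ps ≡ -1ℤ ^ numEdgesG' ps
proposition5p3 ps partition _ admissible =
  -1^-cong-parity (t + s) e
    (sign-parity t b s e x (chainsOneMod3-parity partition admissible) (numEdgesG'+deleted partition admissible))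
  where
  t s b e x : ℕ
  t = length (filter (λ m → m % 3 ≟ 1) (SIG ps))
  s = length (μ₂ ps)
  b = length (successors ps)
  e = numEdgesG' ps
  x = length (deletedEdges ps)
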